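{- Let $k\ge 2$ be an integer and let $T$ be a tree of order at least $k$. Then $T$ has a proper coloring with colors from $\{0,1,\dots,k-1\}$ such that for every vertex $w$ of $T$ and every color $i\in\{0,1,\dots,k-1\}$, there is a vertex of color $i$ at distance at most $k-1$ from $w$.
   Context: A proper coloring assigns colors to vertices so that adjacent vertices receive different colors. Distance is the usual shortest-path distance in $T$ (a vertex is at distance $0$ from itself). -}

module Defs where

open import Data.Nat using (ℕ; zero; suc; _≤_; _<_)
open import Data.Fin using (Fin)
open import Data.List using (List; []; _∷_)
open import Data.List.Relation.Unary.Unique.Propositional using (Unique)
open import Data.Product using (Σ; ∃; ∃-syntax; _×_; _,_)
open import Relation.Binary.PropositionalEquality using (_≡_)
open import Relation.Nullary using (¬_)

record Graph (n : ℕ) : Set₁ where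
  field
    Adj   : Fin n → Fin n → Set
    sym   : ∀ {u v} → Adj u v → Adj v u
    irrefl : ∀ {v} → ¬ Adj v v
open Graph public

module _ {n : ℕ} (G : Graph n) where

  data Walk : ℕ → Fin n → Fin n → Set where
    here : ∀ {v} → Walk zero v v
    step : ∀ {ℓ u w v} → Adj G u w → Walk ℓ w v → Walk (suc ℓ) u v

  verts : ∀ {ℓ u v} → Walk ℓ u v → List (Fin n)
  verts {u = u} here       = u ∷ []
  verts {u = u} (step _ p) = u ∷ verts p

  inner : ∀ {ℓ u v} → Walk ℓ u v → List (Fin n)
  inner here                = []
  inner {u = u} (step _ p)  = u ∷ inner p

  Connected : Set
  Connected = ∀ u v → ∃[ ℓ ] Walk ℓ u v

  -- A cycle: a closed walk of length at least 3 whose vertices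
  -- (omitting the repeated final vertex) are pairwise distinct.
  record Cycle : Set where
    field
      start  : Fin n
      next   : Fin n
      len    : ℕ
      edge   : Adj G start next
      rest   : Walk len next start
      long   : 2 ≤ len                  -- total length len+1 ≥ 3
      simple : Unique (start ∷ inner rest)

  IsTree : Set
  IsTree = Connected × ¬ Cycle

  -- dist(u,v) ≤ d : some walk (equivalently, a shortest path) from u to v
  -- has length at most d.
  DistLE : Fin n → Fin n → ℕ → Set
  DistLE u v d = ∃[ ℓ ] (ℓ ≤ d × Walk ℓ u v)

  ProperColoring : ∀ {k} → (Fin n → Fin k) → Set
  ProperColoring c = ∀ {u v} → Adj G u v → ¬ c u ≡ c v

{-# OPTIONS --safe #-}

-- Root the tree at an end r of a longest path x … r and color v by dist v r mod k. The levels dist · r of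
-- adjacent vertices differ by exactly one, so this coloring is proper. If the diameter is at least k − 1, every
-- vertex w sees all colors nearby: walking from w towards r the level drops by one per step, which covers the
-- residues of the k levels up to dist w r, and a level i < k above dist w r is met within i steps on the way
-- from w to x, because maximality of the diameter forces the level after t steps towards x to be at least t.
-- If the diameter is below k − 1, all vertices are within distance k − 1 of each other and it suffices to color
-- properly with all k colors, which n ≥ k allows: label the vertices so that the ends of an edge get 0 and 1,
-- give each vertex with label below k that label and every other vertex its side of the bipartition.
module Submission where

open import Defs
open import Data.Nat using (ℕ; zero; suc; 2+; _+_; _*_; _∸_; _≤_; _<_; z≤n; s≤s; s≤s⁻¹; _≤?_; _<?_; NonZero)
  renaming (_≟_ to _≟ℕ_)
open import Data.Nat.Properties
  using ( ≤-refl; ≤-reflexive; ≤-trans; ≤-antisym; <⇒≤; <⇒≱; ≰⇒>; ≮⇒≥; ≤∧≢⇒<; m≤n⇒m<n∨m≡n; m≤n⇒m≤1+n; n≤0⇒n≡0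
        ; suc-injective; 0≢1+n; 1+n≢n; +-monoʳ-≤; +-cancelˡ-≤; m∸n≤m; m∸n+n≡m; m+[n∸m]≡n; m∸[m∸n]≡n; ∸-+-assoc )
open import Data.Nat.DivMod
  using (_%_; _/_; _mod_; m%n<n; m<n⇒m%n≡m; n%n≡0; %-distribˡ-+; [m+kn]%n≡m%n; m%n≡m∸m/n*n; m/n*n≤m)
open import Data.Fin using (Fin; suc; toℕ; fromℕ<; inject≤)
open import Data.Fin.Patterns using (0F; 1F)
open import Data.Fin.Properties using (toℕ-injective; toℕ-fromℕ<; toℕ-inject≤; toℕ<n; _≟_)
open import Data.Fin.Permutation using (Permutation′; _⟨$⟩ʳ_; _⟨$⟩ˡ_; inverseˡ; inverseʳ; transpose)
import Data.Fin.Permutation.Components as PC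
open import Data.List using (_∷_; _++_; _∷ʳ_; allFin; cartesianProduct)
import Data.List as List
open import Data.List.Properties using (unfold-reverse)
open import Data.List.Membership.Propositional using (_∈_; _∉_)
open import Data.List.Membership.Propositional.Properties using (∈-++⁻; ∈-allFin; ∈-cartesianProduct⁺)
import Data.List.Membership.DecPropositional as DecMembership
open import Data.List.Relation.Binary.Subset.Propositional using (_⊆_)
open import Data.List.Relation.Binary.Subset.Propositional.Properties using (xs⊆x∷xs; ∷⁺ʳ)
open import Data.List.Relation.Unary.Any using (here; there)
open import Data.List.Relation.Unary.Any.Properties using (reverse⁻)
open import Data.List.Relation.Unary.All as All using ([])
open import Data.List.Relation.Unary.All.Properties using (All¬⇒¬Any; ¬Any⇒All¬)
open import Data.List.Relation.Unary.AllPairs using ([]; _∷_)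
open import Data.List.Relation.Unary.Unique.Propositional using (Unique)
open import Data.List.Extrema.Nat using (argmax; f[xs]≤f[argmax])
open import Data.Product using (∃-syntax; _×_; _,_; proj₁; proj₂; uncurry)
open import Data.Sum using (_⊎_; inj₁; inj₂)
open import Data.Empty using (⊥-elim)
open import Function using (_∘_; id)
import Relation.Binary.PropositionalEquality as ≡
open ≡ using (_≡_; _≢_; refl; cong; subst; module ≡-Reasoning)
open import Relation.Nullary using (¬_; yes; no)

AllColorsWithin : ∀ {n} → Graph n → ℕ → ℕ → Set
AllColorsWithin {n} G k d =
  ∃[ c ] (ProperColoring G {k} c × (∀ (w : Fin n) (i : Fin k) → ∃[ v ] (c v ≡ i × DistLE G w v d)))

m≤n⇒n≤[n∸m]+o⇒m≤o : ∀ {m n o} → m ≤ n → n ≤ (n ∸ m) + o → m ≤ o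
m≤n⇒n≤[n∸m]+o⇒m≤o {m} {n} {o} m≤n n≤ =
  +-cancelˡ-≤ (n ∸ m) m o (subst (_≤ (n ∸ m) + o) (≡.sym (m∸n+n≡m m≤n)) n≤)

congruent-below : ∀ m i n .{{_ : NonZero n}} → i ≤ m → ∃[ t ] (t ≤ m × m ∸ t < n × t % n ≡ i % n)
congruent-below m i n i≤m = i + q * n , t≤m , gap , [m+kn]%n≡m%n i q n
  where
    q = (m ∸ i) / n
    t≤m : i + q * n ≤ m
    t≤m = ≤-trans (+-monoʳ-≤ i (m/n*n≤m (m ∸ i) n)) (≤-reflexive (m+[n∸m]≡n i≤m))
    gap : m ∸ (i + q * n) < n
    gap = subst (_< n) (≡.trans (m%n≡m∸m/n*n (m ∸ i) n) (∸-+-assoc m i (q * n))) (m%n<n (m ∸ i) n)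

suc-%-≢ : ∀ m n .{{_ : NonZero n}} → 1 < n → suc m % n ≢ m % n
suc-%-≢ m n@(suc (suc k)) (s≤s (s≤s z≤n)) eq with m≤n⇒m<n∨m≡n (m%n<n m n)
... | inj₁ 1+r<n = 1+n≢n (begin
  suc (m % n)         ≡⟨ m<n⇒m%n≡m 1+r<n ⟨
  suc (m % n) % n     ≡⟨ %-distribˡ-+ 1 m n ⟨
  suc m % n           ≡⟨ eq ⟩
  m % n               ∎)
  where open ≡-Reasoning
... | inj₂ 1+r≡n = 0≢1+n (begin
  0                   ≡⟨ n%n≡0 n ⟨
  n % n               ≡⟨ cong (_% n) 1+r≡n ⟨
  suc (m % n) % n     ≡⟨ %-distribˡ-+ 1 m n ⟨
  suc m % n           ≡⟨ eq ⟩
  m % n               ≡⟨ suc-injective 1+r≡n ⟩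
  suc k               ∎)
  where open ≡-Reasoning

mod≡⇒%≡ : ∀ {m o n} .{{_ : NonZero n}} → m mod n ≡ o mod n → m % n ≡ o % n
mod≡⇒%≡ eq = ≡.trans (≡.sym (toℕ-fromℕ< _)) (≡.trans (cong toℕ eq) (toℕ-fromℕ< _))

%≡toℕ⇒mod≡ : ∀ {m n} .{{_ : NonZero n}} {i : Fin n} → m % n ≡ toℕ i → m mod n ≡ i
%≡toℕ⇒mod≡ eq = toℕ-injective (≡.trans (toℕ-fromℕ< _) eq)

transpose-other : ∀ {n} {i j k : Fin n} → k ≢ i → k ≢ j → PC.transpose i j k ≡ k
transpose-other {i = i} {j} {k} k≢i k≢j with k ≟ i
... | yes k≡i = ⊥-elim (k≢i k≡i)
... | no  _   with k ≟ j
...   | yes k≡j = ⊥-elim (k≢j k≡j)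
...   | no  _   = refl

argmax₂ : ∀ {m} (f : Fin (suc m) → Fin (suc m) → ℕ) → ∃[ x ] ∃[ y ] (∀ a b → f a b ≤ f x y)
argmax₂ {m} f = proj₁ best , proj₂ best , λ a b →
  All.lookup (f[xs]≤f[argmax] {f = uncurry f} (0F , 0F) pairs) (∈-cartesianProduct⁺ (∈-allFin a) (∈-allFin b))
  where
    pairs = cartesianProduct (allFin (suc m)) (allFin (suc m))
    best = argmax (uncurry f) (0F , 0F) pairs

module WalkProperties {n : ℕ} (G : Graph n) where
  open DecMembership (_≟_ {n}) using (_∈?_)

  infixl 5 _▷_
  infixr 5 _++ᵂ_

  _▷_ : ∀ {ℓ u v w} → Walk G ℓ u v → Adj G v w → Walk G (suc ℓ) u w
  here     ▷ f = step f here
  step e p ▷ f = step e (p ▷ f)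

  _++ᵂ_ : ∀ {ℓ m u v w} → Walk G ℓ u v → Walk G m v w → Walk G (ℓ + m) u w
  here     ++ᵂ q = q
  step e p ++ᵂ q = step e (p ++ᵂ q)

  reverse : ∀ {ℓ u v} → Walk G ℓ u v → Walk G ℓ v u
  reverse here       = here
  reverse (step e p) = reverse p ▷ sym G e

  splitAt : ∀ {ℓ u v} m → m ≤ ℓ → Walk G ℓ u v → ∃[ z ] (Walk G m u z × Walk G (ℓ ∸ m) z v)
  splitAt zero    _         p          = _ , here , p
  splitAt (suc m) (s≤s m≤ℓ) (step e p) with splitAt m m≤ℓ p
  ... | z , front , back = z , step e front , back

  end∈verts : ∀ {ℓ u v} (p : Walk G ℓ u v) → v ∈ verts G p
  end∈verts here       = here refl
  end∈verts (step _ p) = there (end∈verts p)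

  verts-▷ : ∀ {ℓ u v w} (p : Walk G ℓ u v) (f : Adj G v w) → verts G (p ▷ f) ≡ verts G p ∷ʳ w
  verts-▷ here       f = refl
  verts-▷ (step e p) f = cong (_ ∷_) (verts-▷ p f)

  inner-▷ : ∀ {ℓ u v w} (p : Walk G ℓ u v) (f : Adj G v w) → inner G (p ▷ f) ≡ verts G p
  inner-▷ here       f = refl
  inner-▷ (step e p) f = cong (_ ∷_) (inner-▷ p f)

  verts-reverse : ∀ {ℓ u v} (p : Walk G ℓ u v) → verts G (reverse p) ≡ List.reverse (verts G p)
  verts-reverse here = refl
  verts-reverse {u = u} (step e p) = begin
    verts G (reverse p ▷ sym G e)     ≡⟨ verts-▷ (reverse p) (sym G e) ⟩
    verts G (reverse p) ∷ʳ u          ≡⟨ cong (_∷ʳ u) (verts-reverse p) ⟩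
    List.reverse (verts G p) ∷ʳ u     ≡⟨ unfold-reverse u (verts G p) ⟨
    List.reverse (u ∷ verts G p)      ∎
    where open ≡-Reasoning

  verts-reverse⊆ : ∀ {ℓ u v} (p : Walk G ℓ u v) → verts G (reverse p) ⊆ verts G p
  verts-reverse⊆ p x∈ = reverse⁻ (subst (_ ∈_) (verts-reverse p) x∈)

  verts-++ᵂ⊆ : ∀ {ℓ m u v w} (p : Walk G ℓ u v) (q : Walk G m v w) →
               verts G (p ++ᵂ q) ⊆ verts G p ++ verts G q
  verts-++ᵂ⊆ here       q = xs⊆x∷xs _ _
  verts-++ᵂ⊆ (step e p) q = ∷⁺ʳ _ (verts-++ᵂ⊆ p q)

  IsPath : ∀ {ℓ u v} → Walk G ℓ u v → Set
  IsPath p = Unique (verts G p)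

  record Suffix {ℓ u v} (p : Walk G ℓ u v) (x : Fin n) : Set where
    field
      {len}   : ℕ
      walk    : Walk G len x v
      len≤    : len ≤ ℓ
      verts⊆  : verts G walk ⊆ verts G p
      isPath  : IsPath p → IsPath walk

  suffix : ∀ {ℓ u v x} (p : Walk G ℓ u v) → x ∈ verts G p → Suffix p x
  suffix here         (here refl) = record { walk = here ; len≤ = ≤-refl ; verts⊆ = id ; isPath = id }
  suffix p@(step _ _) (here refl) = record { walk = p    ; len≤ = ≤-refl ; verts⊆ = id ; isPath = id }
  suffix (step e p)   (there x∈p) = record
    { walk   = walk
    ; len≤   = m≤n⇒m≤1+n len≤
    ; verts⊆ = there ∘ verts⊆
    ; isPath = λ { (_ ∷ p-path) → isPath p-path }
    }
    where open Suffix (suffix p x∈p)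

  strict-suffix : ∀ {ℓ u v x} (p : Walk G ℓ u v) → x ∈ verts G p → x ≢ u → ∃[ m ] (m < ℓ × Walk G m x v)
  strict-suffix here       (here refl) x≢u = ⊥-elim (x≢u refl)
  strict-suffix (step e p) (here refl) x≢u = ⊥-elim (x≢u refl)
  strict-suffix (step e p) (there x∈p) _   = len , s≤s len≤ , walk
    where open Suffix (suffix p x∈p)

  record PathIn {ℓ u v} (p : Walk G ℓ u v) : Set where
    field
      {len}  : ℕ
      path   : Walk G len u v
      len≤   : len ≤ ℓ
      isPath : IsPath path
      verts⊆ : verts G path ⊆ verts G p

  toPath : ∀ {ℓ u v} (p : Walk G ℓ u v) → PathIn p
  toPath here = record { path = here ; len≤ = z≤n ; isPath = [] ∷ [] ; verts⊆ = id }
  toPath {u = u} (step e p) with P ← toPath p | u ∈? verts G (PathIn.path P)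
  ... | yes u∈P = record
    { path   = S.walk
    ; len≤   = m≤n⇒m≤1+n (≤-trans S.len≤ P.len≤)
    ; isPath = S.isPath P.isPath
    ; verts⊆ = there ∘ P.verts⊆ ∘ S.verts⊆
    }
    where
      module P = PathIn P
      module S = Suffix (suffix P.path u∈P)
  ... | no u∉P = record
    { path   = step e P.path
    ; len≤   = s≤s P.len≤
    ; isPath = ¬Any⇒All¬ _ u∉P ∷ P.isPath
    ; verts⊆ = ∷⁺ʳ u P.verts⊆
    }
    where module P = PathIn P

  neighbour-towards : ∀ {ℓ u v} → u ≢ v → Walk G ℓ u v → ∃[ w ] Adj G u w
  neighbour-towards u≢v here       = ⊥-elim (u≢v refl)
  neighbour-towards _   (step e _) = _ , e

  DistLE-step : ∀ {u w v d} → Adj G u w → DistLE G w v d → DistLE G u v (suc d)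
  DistLE-step e (ℓ , ℓ≤d , p) = suc ℓ , s≤s ℓ≤d , step e p

  DistLE-mono : ∀ {u v d d′} → d ≤ d′ → DistLE G u v d → DistLE G u v d′
  DistLE-mono d≤d′ (ℓ , ℓ≤d , p) = ℓ , ≤-trans ℓ≤d d≤d′ , p

  intermediate-value : (f : Fin n → ℕ) → (∀ {u v} → Adj G u v → f v ≤ suc (f u)) →
                       ∀ {ℓ u z t} → Walk G ℓ u z → f u ≤ t → t ≤ f z →
                       ∃[ y ] (f y ≡ t × DistLE G u y ℓ)
  intermediate-value f lip here fu≤t t≤fz = _ , ≤-antisym fu≤t t≤fz , 0 , z≤n , here
  intermediate-value f lip {u = u} {t = t} (step e p) fu≤t t≤fz with f u ≟ℕ t
  ... | yes fu≡t = u , fu≡t , 0 , z≤n , here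
  ... | no  fu≢t
    with y , fy≡t , near ← intermediate-value f lip p (≤-trans (lip e) (≤∧≢⇒< fu≤t fu≢t)) t≤fz
    = y , fy≡t , DistLE-step e near

mod-proper : ∀ {n} (G : Graph n) (f : Fin n → ℕ) →
             (∀ {u v} → Adj G u v → f u ≡ suc (f v) ⊎ f v ≡ suc (f u)) →
             ∀ k .{{_ : NonZero k}} → 1 < k → ProperColoring G (λ v → f v mod k)
mod-proper G f graded k 1<k {u} {v} e cu≡cv with graded e
... | inj₁ fu≡ = suc-%-≢ (f v) k 1<k (subst (λ x → x % k ≡ f v % k) fu≡ (mod≡⇒%≡ cu≡cv))
... | inj₂ fv≡ = suc-%-≢ (f u) k 1<k (subst (λ x → x % k ≡ f u % k) fv≡ (mod≡⇒%≡ (≡.sym cu≡cv)))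

module Acyclic {n : ℕ} (G : Graph n) (acyclic : ¬ Cycle G) where
  open WalkProperties G

  closing-cycle : ∀ {j u a b} → Adj G u a → Adj G b u → a ≢ b →
                  (P : Walk G j a b) → IsPath P → u ∉ verts G P → Cycle G
  closing-cycle e f a≢b here _ _ = ⊥-elim (a≢b refl)
  closing-cycle {u = u} e f a≢b P@(step _ _) P-path u∉P = record
    { start  = u
    ; next   = _
    ; len    = _
    ; edge   = e
    ; rest   = P ▷ f
    ; long   = s≤s (s≤s z≤n)
    ; simple = subst (Unique ∘ (u ∷_)) (≡.sym (inner-▷ P f)) (¬Any⇒All¬ _ u∉P ∷ P-path)
    }

  -- Two paths from u that leave through different neighbours a, b close up, through a path from a to b
  -- inside the rest of them, to a cycle through u.
  path-length-unique : ∀ {ℓ m u v} (p : Walk G ℓ u v) (q : Walk G m u v) → IsPath p → IsPath q → ℓ ≡ m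
  path-length-unique here       here       _           _           = refl
  path-length-unique here       (step _ q) _           (u∉q ∷ _)   = ⊥-elim (All¬⇒¬Any u∉q (end∈verts q))
  path-length-unique (step _ p) here       (u∉p ∷ _)   _           = ⊥-elim (All¬⇒¬Any u∉p (end∈verts p))
  path-length-unique {u = u} (step {w = a} e p) (step {w = b} f q) (u∉p ∷ p-path) (u∉q ∷ q-path)
    with a ≟ b
  ... | yes refl = cong suc (path-length-unique p q p-path q-path)
  ... | no  a≢b  = ⊥-elim (acyclic (closing-cycle e (sym G f) a≢b P.path P.isPath u∉P))
    where
      module P = PathIn (toPath (p ++ᵂ reverse q))
      u∉P : u ∉ verts G P.path
      u∉P u∈P with ∈-++⁻ (verts G p) (verts-++ᵂ⊆ p (reverse q) (P.verts⊆ u∈P))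
      ... | inj₁ u∈p = All¬⇒¬Any u∉p u∈p
      ... | inj₂ u∈q = All¬⇒¬Any u∉q (verts-reverse⊆ q u∈q)

module SurjectiveColoring
  {m k : ℕ} (G : Graph (2+ m)) (2≤k : 2 ≤ k) (k≤n : k ≤ 2+ m)
  (p : Fin (2+ m) → Fin 2) (p-proper : ProperColoring G p)
  (π : Permutation′ (2+ m)) (p[π⁻¹0]≡0 : p (π ⟨$⟩ˡ 0F) ≡ 0F) (p[π⁻¹1]≡1 : p (π ⟨$⟩ˡ 1F) ≡ 1F)
  where

  color : Fin (2+ m) → Fin k
  color v with toℕ (π ⟨$⟩ʳ v) <? k
  ... | yes πv<k = fromℕ< πv<k
  ... | no  _    = inject≤ (p v) 2≤k

  π-agrees-with-p : ∀ v → toℕ (π ⟨$⟩ʳ v) < 2 → toℕ (π ⟨$⟩ʳ v) ≡ toℕ (p v)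
  π-agrees-with-p v πv<2 with π ⟨$⟩ʳ v | inverseˡ π {v}
  ... | 0F          | π⁻¹0≡v = cong toℕ (≡.sym (subst (λ u → p u ≡ 0F) π⁻¹0≡v p[π⁻¹0]≡0))
  ... | 1F          | π⁻¹1≡v = cong toℕ (≡.sym (subst (λ u → p u ≡ 1F) π⁻¹1≡v p[π⁻¹1]≡1))
  ... | suc (suc _) | _      with s≤s (s≤s ()) ← πv<2

  color-π : ∀ v → toℕ (π ⟨$⟩ʳ v) < k → toℕ (color v) ≡ toℕ (π ⟨$⟩ʳ v)
  color-π v πv<k with toℕ (π ⟨$⟩ʳ v) <? k
  ... | yes πv<k = toℕ-fromℕ< πv<k
  ... | no  πv≮k = ⊥-elim (πv≮k πv<k)

  color-low : ∀ v → toℕ (color v) < 2 → toℕ (color v) ≡ toℕ (p v)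
  color-low v cv<2 with toℕ (π ⟨$⟩ʳ v) <? k
  ... | yes πv<k = ≡.trans (toℕ-fromℕ< πv<k)
                     (π-agrees-with-p v (subst (_< 2) (toℕ-fromℕ< πv<k) cv<2))
  ... | no  _    = toℕ-inject≤ (p v) 2≤k

  color-high : ∀ v → 2 ≤ toℕ (color v) → toℕ (color v) ≡ toℕ (π ⟨$⟩ʳ v)
  color-high v 2≤cv with toℕ (π ⟨$⟩ʳ v) <? k
  ... | yes πv<k = toℕ-fromℕ< πv<k
  ... | no  _    = ⊥-elim (<⇒≱ (subst (_< 2) (≡.sym (toℕ-inject≤ (p v) 2≤k)) (toℕ<n (p v))) 2≤cv)

  -- Adjacent vertices cannot share a color below 2, which comes from p, nor one above, which comes from
  -- the injective π.
  color-proper : ProperColoring G color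
  color-proper {u} {v} e cu≡cv with toℕ (color u) <? 2
  ... | yes cu<2 = p-proper e (toℕ-injective (begin
    toℕ (p u)      ≡⟨ color-low u cu<2 ⟨
    toℕ (color u)  ≡⟨ cong toℕ cu≡cv ⟩
    toℕ (color v)  ≡⟨ color-low v (subst (λ c → toℕ c < 2) cu≡cv cu<2) ⟩
    toℕ (p v)      ∎))
    where open ≡-Reasoning
  ... | no  cu≮2 = irrefl G (subst (Adj G u) (≡.sym u≡v) e)
    where
      πu≡πv : π ⟨$⟩ʳ u ≡ π ⟨$⟩ʳ v
      πu≡πv = toℕ-injective (begin
        toℕ (π ⟨$⟩ʳ u)  ≡⟨ color-high u (≮⇒≥ cu≮2) ⟨
        toℕ (color u)   ≡⟨ cong toℕ cu≡cv ⟩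
        toℕ (color v)   ≡⟨ color-high v (subst (λ c → 2 ≤ toℕ c) cu≡cv (≮⇒≥ cu≮2)) ⟩
        toℕ (π ⟨$⟩ʳ v)  ∎)
        where open ≡-Reasoning
      u≡v : u ≡ v
      u≡v = ≡.trans (≡.sym (inverseˡ π)) (≡.trans (cong (π ⟨$⟩ˡ_) πu≡πv) (inverseˡ π))

  color-surjective : ∀ i → ∃[ v ] (color v ≡ i)
  color-surjective i = v , toℕ-injective (≡.trans (color-π v πv<k) πv≡i)
    where
      v = π ⟨$⟩ˡ inject≤ i k≤n
      πv≡i : toℕ (π ⟨$⟩ʳ v) ≡ toℕ i
      πv≡i = ≡.trans (cong toℕ (inverseʳ π)) (toℕ-inject≤ i k≤n)
      πv<k : toℕ (π ⟨$⟩ʳ v) < k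
      πv<k = subst (_< k) (≡.sym πv≡i) (toℕ<n i)

module Tree {n : ℕ} (T : Graph n) (tree : IsTree T) where
  open WalkProperties T
  open Acyclic T (proj₂ tree)
  open DecMembership (_≟_ {n}) using (_∈?_)

  private
    geodesicIn : ∀ u v → PathIn (proj₂ (proj₁ tree u v))
    geodesicIn u v = toPath _

  dist : Fin n → Fin n → ℕ
  dist u v = PathIn.len (geodesicIn u v)

  geodesic : ∀ u v → Walk T (dist u v) u v
  geodesic u v = PathIn.path (geodesicIn u v)

  geodesic-isPath : ∀ u v → IsPath (geodesic u v)
  geodesic-isPath u v = PathIn.isPath (geodesicIn u v)

  dist-minimal : ∀ {ℓ u v} → Walk T ℓ u v → dist u v ≤ ℓ
  dist-minimal {u = u} {v} p =
    subst (_≤ _) (path-length-unique P.path (geodesic u v) P.isPath (geodesic-isPath u v)) P.len≤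
    where module P = PathIn (toPath p)

  dist-self : ∀ {u} → dist u u ≡ 0
  dist-self = n≤0⇒n≡0 (dist-minimal here)

  dist-step : ∀ {u v r} → Adj T u v → dist v r ≤ suc (dist u r)
  dist-step {u} {r = r} e = dist-minimal (step (sym T e) (geodesic u r))

  -- If u lies on the geodesic from v to r, its tail from u is shorter; otherwise prepending u to it gives a path.
  dist-adjacent : ∀ {u v r} → Adj T u v → dist u r ≡ suc (dist v r) ⊎ dist v r ≡ suc (dist u r)
  dist-adjacent {u} {v} {r} e with u ∈? verts T (geodesic v r)
  ... | yes u∈
    with m , m<d , tail ← strict-suffix (geodesic v r) u∈ (λ u≡v → irrefl T (subst (Adj T u) (≡.sym u≡v) e))
    = inj₂ (≤-antisym (dist-step e) (≤-trans (s≤s (dist-minimal tail)) m<d))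
  ... | no u∉ = inj₁ (path-length-unique (geodesic u r) (step e (geodesic v r))
                        (geodesic-isPath u r) (¬Any⇒All¬ _ u∉ ∷ geodesic-isPath v r))

  dist-neighbour : ∀ {u v} → Adj T u v → dist v u ≡ 1
  dist-neighbour {u} e with dist-adjacent {r = u} e
  ... | inj₁ du≡ = ⊥-elim (0≢1+n (≡.trans (≡.sym dist-self) du≡))
  ... | inj₂ dv≡ = ≡.trans dv≡ (cong suc dist-self)

  descend : ∀ {w r t} → t ≤ dist w r → ∃[ y ] (dist y r ≡ t × DistLE T w y (dist w r ∸ t))
  descend {w} {r} {t} t≤d with z , front , back ← splitAt (dist w r ∸ t) (m∸n≤m _ t) (geodesic w r)
    = z , ≤-antisym below above , _ , ≤-refl , front
    where
      below : dist z r ≤ t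
      below = subst (dist z r ≤_) (m∸[m∸n]≡n t≤d) (dist-minimal back)
      above : t ≤ dist z r
      above = m≤n⇒n≤[n∸m]+o⇒m≤o t≤d (dist-minimal (front ++ᵂ geodesic z r))

  module _ {x r : Fin n} (diametral : ∀ a b → dist a b ≤ dist x r) where

    -- After t steps from w towards x the level is at least t, as otherwise dist x r < dist w x.
    ascend : ∀ {w t} → dist w r ≤ t → t ≤ dist x r → ∃[ y ] (dist y r ≡ t × DistLE T w y t)
    ascend {w} {t} dw≤t t≤D with t ≤? dist w x
    ... | yes t≤L with z , front , back ← splitAt t t≤L (geodesic w x)
      = intermediate-value (λ v → dist v r) dist-step front dw≤t
          (m≤n⇒n≤[n∸m]+o⇒m≤o t≤L (≤-trans (diametral w x) (dist-minimal (reverse back ++ᵂ geodesic z r))))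
    ... | no t≰L
      with y , dy≡t , near ← intermediate-value (λ v → dist v r) dist-step (geodesic w x) dw≤t t≤D
      = y , dy≡t , DistLE-mono (<⇒≤ (≰⇒> t≰L)) near

    long-diameter : ∀ K → 0 < K → K ≤ dist x r → AllColorsWithin T (suc K) K
    long-diameter K 0<K K≤D =
      level , mod-proper T (λ v → dist v r) dist-adjacent (suc K) (s≤s 0<K) , nearby
      where
        level : Fin n → Fin (suc K)
        level v = dist v r mod suc K

        reach : ∀ w (i : Fin (suc K)) → ∃[ y ] (dist y r % suc K ≡ toℕ i × DistLE T w y K)
        reach w i with toℕ i ≤? dist w r
        ... | yes i≤d with t , t≤d , gap , t≡i ← congruent-below (dist w r) (toℕ i) (suc K) i≤d
          with y , dy≡t , near ← descend t≤d
          = y , (begin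
              dist y r % suc K    ≡⟨ cong (_% suc K) dy≡t ⟩
              t % suc K           ≡⟨ t≡i ⟩
              toℕ i % suc K       ≡⟨ m<n⇒m%n≡m (toℕ<n i) ⟩
              toℕ i               ∎) , DistLE-mono (s≤s⁻¹ gap) near
          where open ≡-Reasoning
        reach w i | no i≰d
          with y , dy≡i , near ← ascend (<⇒≤ (≰⇒> i≰d)) (≤-trans (s≤s⁻¹ (toℕ<n i)) K≤D)
          = y , ≡.trans (cong (_% suc K) dy≡i) (m<n⇒m%n≡m (toℕ<n i)) , DistLE-mono (s≤s⁻¹ (toℕ<n i)) near

        nearby : ∀ w i → ∃[ v ] (level v ≡ i × DistLE T w v K)
        nearby w i with y , y≡i , near ← reach w i = y , %≡toℕ⇒mod≡ {dist y r} y≡i , near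

-- The parity of the distance to 0F colors 0F and a neighbour b of it differently, and the transposition of 1F and b
-- makes this 2-coloring agree with the labels 0F , 1F.
short-diameter : ∀ {m k d} (T : Graph (2+ m)) (tree : IsTree T) → (∀ a b → Tree.dist T tree a b ≤ d) →
                 2 ≤ k → k ≤ 2+ m → AllColorsWithin T k d
short-diameter {m} {k} {d} T tree small 2≤k k≤n = color , color-proper , nearby
  where
    open WalkProperties T using (neighbour-towards)
    open Tree T tree

    b : Fin (2+ m)
    b = proj₁ (neighbour-towards (λ ()) (geodesic 0F 1F))
    0F~b : Adj T 0F b
    0F~b = proj₂ (neighbour-towards (λ ()) (geodesic 0F 1F))

    parity : Fin (2+ m) → Fin 2
    parity v = dist v 0F mod 2

    parity-0F : parity (PC.transpose 1F b 0F) ≡ 0F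
    parity-0F = ≡.trans (cong parity (transpose-other {i = 1F} {b} (λ ()) 0F≢b)) (cong (_mod 2) dist-self)
      where
        0F≢b : 0F ≢ b
        0F≢b 0F≡b = irrefl T (subst (Adj T 0F) (≡.sym 0F≡b) 0F~b)

    open SurjectiveColoring T 2≤k k≤n parity (mod-proper T (λ v → dist v 0F) dist-adjacent 2 (s≤s (s≤s z≤n)))
                            (transpose b 1F) parity-0F (cong (_mod 2) (dist-neighbour 0F~b))

    nearby : ∀ w i → ∃[ v ] (color v ≡ i × DistLE T w v d)
    nearby w i with v , cv≡i ← color-surjective i = v , cv≡i , dist w v , small w v , geodesic w v

tree-coloring : ∀ {m K} (T : Graph (2+ m)) (tree : IsTree T) → 2+ K ≤ 2+ m →
                ∃[ x ] ∃[ r ] (∀ a b → Tree.dist T tree a b ≤ Tree.dist T tree x r) →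
                AllColorsWithin T (2+ K) (suc K)
tree-coloring {K = K} T tree k≤n (x , r , diametral) with suc K ≤? Tree.dist T tree x r
... | yes K<D = Tree.long-diameter T tree diametral (suc K) (s≤s z≤n) K<D
... | no  K≮D =
  short-diameter T tree (λ a b → ≤-trans (diametral a b) (<⇒≤ (≰⇒> K≮D))) (s≤s (s≤s z≤n)) k≤n

theorem2 : (k : ℕ) → 2 ≤ k → (n : ℕ) → k ≤ n → (T : Graph n) → IsTree T →
    ∃[ c ] (ProperColoring T {k} c ×
      (∀ (w : Fin n) (i : Fin k) → ∃[ v ] (c v ≡ i × DistLE T w v (k ∸ 1))))
theorem2 (2+ K) _        (2+ m) k≤n      T tree = tree-coloring T tree k≤n (argmax₂ (Tree.dist T tree))
theorem2 (2+ K) _        1      (s≤s ()) _ _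
theorem2 1      (s≤s ()) _      _        _ _
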